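{- A graph $G$ is good if and only if $G$ has no induced subgraph isomorphic to any of: the gem; the graph $C_4+K_1$ with an added universal vertex; the local complement of the latter graph with respect to its universal vertex; the graph $3K_2$ with an added universal vertex; the octahedron with an added universal vertex.
   Context: Graphs are finite and simple. A threshold graph is a graph in which every induced subgraph has an isolated vertex or a universal vertex. The union of two vertex-disjoint graphs is their disjoint union; their join is the union plus all edges between the two vertex sets. A vertex $x$ of $G$ is good if the subgraph induced by its open neighborhood $N(x)$ is empty (i.e. $N(x)=\varnothing$), or a threshold graph, or the union of two threshold graphs, or the join of two threshold graphs. $G$ is good if every vertex is good. Local complementation at $x$ replaces the subgraph induced by $N(x)$ by its complement. The gem is $P_4$ plus a vertex adjacent to all its vertices; $C_4+K_1$ is a 4-cycle plus an isolated vertex; $3K_2$ is three disjoint edges; the octahedron is $K_{2,2,2}$; "with an added universal vertex" means adding a new vertex adjacent to all vertices. -}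

module Defs where

open import Data.Bool using (Bool; true; false; not; _∧_; _∨_; if_then_else_)
open import Data.Nat using (ℕ; suc; _+_; _≡ᵇ_)
open import Data.Fin using (Fin; zero; suc; toℕ; splitAt; _≟_)
open import Data.Fin.Subset using (Subset; _∈_; _∉_; _⊆_; Nonempty; Empty)
open import Data.Vec using (tabulate)
open import Data.List using (List; []; _∷_)
open import Data.Bool.ListAction using (any)
open import Data.Product using (_×_; _,_; Σ; ∃; ∃-syntax)
open import Data.Sum using (_⊎_; inj₁; inj₂)
open import Relation.Binary.PropositionalEquality using (_≡_; _≢_)
open import Relation.Nullary using (does; ¬_)
open import Function.Definitions using (Injective)

Graph : ℕ → Set
Graph n = Fin n → Fin n → Bool

IsSimple : ∀ {n} → Graph n → Set
IsSimple {n} G = (∀ (i j : Fin n) → G i j ≡ G j i) × (∀ (i : Fin n) → G i i ≡ false)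

IsThreshold : ∀ {n} → Graph n → Subset n → Set
IsThreshold {n} G A =
  ∀ (T : Subset n) → T ⊆ A → Nonempty T →
    ∃[ v ] (v ∈ T ×
      ((∀ w → w ∈ T → w ≢ v → G v w ≡ false) ⊎
       (∀ w → w ∈ T → w ≢ v → G v w ≡ true)))

IsPartition : ∀ {n} → Subset n → Subset n → Subset n → Set
IsPartition {n} A B C =
  (∀ v → v ∈ A → v ∈ B ⊎ v ∈ C) × (∀ v → v ∈ B → v ∈ A) ×
  (∀ v → v ∈ C → v ∈ A) × (∀ v → v ∈ B → v ∉ C)

IsUnionOfThreshold : ∀ {n} → Graph n → Subset n → Set
IsUnionOfThreshold {n} G A =
  Σ (Subset n) λ B → Σ (Subset n) λ C →
    IsPartition A B C × IsThreshold G B × IsThreshold G C ×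
    (∀ b c → b ∈ B → c ∈ C → G b c ≡ false)

IsJoinOfThreshold : ∀ {n} → Graph n → Subset n → Set
IsJoinOfThreshold {n} G A =
  Σ (Subset n) λ B → Σ (Subset n) λ C →
    IsPartition A B C × IsThreshold G B × IsThreshold G C ×
    (∀ b c → b ∈ B → c ∈ C → G b c ≡ true)

N : ∀ {n} → Graph n → Fin n → Subset n
N G x = tabulate (G x)

GoodVertex : ∀ {n} → Graph n → Fin n → Set
GoodVertex G x =
  Empty (N G x) ⊎ IsThreshold G (N G x) ⊎
  IsUnionOfThreshold G (N G x) ⊎ IsJoinOfThreshold G (N G x)

Good : ∀ {n} → Graph n → Set
Good {n} G = ∀ (x : Fin n) → GoodVertex G x

HasInduced : ∀ {m n} → Graph m → Graph n → Set
HasInduced {m} {n} H G =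
  Σ (Fin m → Fin n) λ f → Injective _≡_ _≡_ f × (∀ i j → H i j ≡ G (f i) (f j))

fromEdges : ∀ {n} → List (ℕ × ℕ) → Graph n
fromEdges es i j = any (λ { (a , b) →
  ((toℕ i ≡ᵇ a) ∧ (toℕ j ≡ᵇ b)) ∨ ((toℕ i ≡ᵇ b) ∧ (toℕ j ≡ᵇ a)) }) es

P4 : Graph 4
P4 = fromEdges ((0 , 1) ∷ (1 , 2) ∷ (2 , 3) ∷ [])

C4 : Graph 4
C4 = fromEdges ((0 , 1) ∷ (1 , 2) ∷ (2 , 3) ∷ (3 , 0) ∷ [])

K1 : Graph 1
K1 = fromEdges []

K2 : Graph 2
K2 = fromEdges ((0 , 1) ∷ [])

_⊕_ : ∀ {m n} → Graph m → Graph n → Graph (m + n)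
_⊕_ {m} G H i j with splitAt m i | splitAt m j
... | inj₁ a | inj₁ b = G a b
... | inj₂ a | inj₂ b = H a b
... | inj₁ _ | inj₂ _ = false
... | inj₂ _ | inj₁ _ = false

complement : ∀ {n} → Graph n → Graph n
complement G i j = if does (i ≟ j) then false else not (G i j)

addUniversal : ∀ {n} → Graph n → Graph (suc n)
addUniversal G zero zero = false
addUniversal G zero (suc j) = true
addUniversal G (suc i) zero = true
addUniversal G (suc i) (suc j) = G i j

localComplement : ∀ {n} → Graph n → Fin n → Graph n
localComplement G x i j =
  if G x i ∧ G x j ∧ not (does (i ≟ j)) then not (G i j) else G i j

gem : Graph 5
gem = addUniversal P4

C4+K1-univ : Graph 6
C4+K1-univ = addUniversal (C4 ⊕ K1)

C4+K1-univ-lc : Graph 6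
C4+K1-univ-lc = localComplement C4+K1-univ zero

3K2-univ : Graph 7
3K2-univ = addUniversal (K2 ⊕ (K2 ⊕ K2))

octahedron : Graph 6
octahedron = complement (K2 ⊕ (K2 ⊕ K2))

octahedron-univ : Graph 7
octahedron-univ = addUniversal octahedron

module Submission where

-- All five forbidden graphs are cones, i.e. a pattern H plus a universal
-- vertex, and G has an induced cone over H iff H occurs in some open
-- neighbourhood N(x) (cone⁺, cone⁻).  The theorem is therefore a statement
-- about vertex sets A: G[A] is empty, threshold, or a union or join of two
-- threshold graphs iff A contains none of P4, C4+K1, the bowtie (the
-- complement of C4+K1), 3K2 and the octahedron (the complement of 3K2).
--   * Threshold graphs are the {P4, C4, 2K2}-free graphs (Threshold): the
--     vicinal preorder is then total, and a greatest vertex is universal or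
--     has an isolated non-neighbour.
--   * Complementation swaps unions and joins and the obstructions in pairs
--     (Duality), so only unions need a construction: given a 2K2 ab, cd, the
--     ball of radius two around a and the rest of A are anticomplete threshold
--     sets (UnionDecomposition).
--   * Conversely, each obstruction survives inside one side of a union or a
--     join (Obstructions).

open import Defs
open import Data.Nat using (ℕ)
open import Data.Product using (_×_)
open import Relation.Nullary using (¬_)
open import Function.Bundles using (_⇔_)

open import Data.Bool using (Bool; true; false; not; if_then_else_)
open import Data.Bool.Properties using (not-involutive; not-¬; ¬-not) renaming (_≟_ to _≟B_)
open import Data.Empty using (⊥-elim)
open import Data.Fin using (Fin; zero; suc; _<_; #_) renaming (_≟_ to _≟F_)
open import Data.Fin.Properties using (any?; all?; ¬∀⟶∃¬; <-cmp; suc-injective)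
open import Data.Fin.Subset using (Subset; _∈_; _⊆_; Nonempty; Empty)
open import Data.Fin.Subset.Properties using (_∈?_)
open import Data.List using (List; []; _∷_; _++_; map; filter; allFin)
open import Data.List.Membership.Propositional using () renaming (_∈_ to _∈ₗ_)
open import Data.List.Membership.Propositional.Properties
  using (∈-allFin; ∈-map⁺; ∈-++⁺ˡ; ∈-++⁺ʳ; ∈-filter⁺)
open import Data.List.Relation.Unary.All as All using (All; []; _∷_)
open import Data.List.Relation.Unary.Any using (here; there)
open import Data.Nat.Base using (zero; suc; s≤s)
open import Data.Product using (Σ; ∃-syntax; _,_; proj₁; proj₂)
open import Data.Sum using (_⊎_; inj₁; inj₂; swap)
open import Data.Vec using (Vec; []; _∷_; tabulate; lookup)
open import Data.Vec.Membership.Propositional.Properties using (∈-lookup)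
open import Data.Vec.Properties using (lookup∘tabulate; []=⇒lookup; lookup⇒[]=)
open import Data.Vec.Relation.Unary.All as VAll using ([]; _∷_)
open import Data.Vec.Functional using () renaming (_∷_ to _◂_)
open import Function.Base using (_∘_)
open import Function.Bundles using (mk⇔)
open import Function.Definitions using (Injective)
open import Relation.Binary.Definitions using (tri<; tri≈; tri>)
open import Relation.Binary.PropositionalEquality
  using (_≡_; _≢_; ≢-sym; refl; sym; trans; cong; cong₂)
open import Relation.Nullary using (Dec; yes; no; does)
open import Relation.Nullary.Decidable
  using (dec-true; from-yes; map′; ¬?; _×-dec_; _⊎-dec_; _→-dec_)

true≢false : true ≢ false
true≢false ()

∈-tabulate⇒true : ∀ {n} {g : Fin n → Bool} {x} → x ∈ tabulate g → g x ≡ true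
∈-tabulate⇒true {g = g} {x} x∈ = trans (sym (lookup∘tabulate g x)) ([]=⇒lookup x∈)

true⇒∈-tabulate : ∀ {n} {g : Fin n → Bool} {x} → g x ≡ true → x ∈ tabulate g
true⇒∈-tabulate {g = g} {x} e = lookup⇒[]= x (tabulate g) (trans (lookup∘tabulate g x) e)

⟦_⟧ : ∀ {n} {P : Fin n → Set} → (∀ x → Dec (P x)) → Subset n
⟦ P? ⟧ = tabulate (λ x → does (P? x))

∈⟦⟧⁺ : ∀ {n} {P : Fin n → Set} (P? : ∀ x → Dec (P x)) {x} → P x → x ∈ ⟦ P? ⟧
∈⟦⟧⁺ P? {x} p = true⇒∈-tabulate (dec-true (P? x) p)

∈⟦⟧⁻ : ∀ {n} {P : Fin n → Set} (P? : ∀ x → Dec (P x)) {x} → x ∈ ⟦ P? ⟧ → P x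
∈⟦⟧⁻ P? {x} x∈ with P? x | ∈-tabulate⇒true x∈
... | yes p | _ = p
... | no _  | ()

separates : ∀ {n} {G : Graph n} {u v w} → G u w ≡ true → G v w ≡ false → u ≢ v
separates e f refl = true≢false (trans (sym e) f)

module SimpleGraph {n} {G : Graph n} (simple : IsSimple G) where

  sym-adj : ∀ {u v b} → G u v ≡ b → G v u ≡ b
  sym-adj {u} {v} e = trans (proj₁ simple v u) e

  loop : ∀ u → G u u ≡ false
  loop = proj₂ simple

  adjacent⇒≢ : ∀ {u v} → G u v ≡ true → u ≢ v
  adjacent⇒≢ {u} e refl = true≢false (trans (sym e) (loop u))

infix 4 _≈ᴳ_
_≈ᴳ_ : ∀ {m} → Graph m → Graph m → Set
H ≈ᴳ H′ = ∀ i j → H i j ≡ H′ i j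

_≈ᴳ?_ : ∀ {m} (H H′ : Graph m) → Dec (H ≈ᴳ H′)
H ≈ᴳ? H′ = all? (λ i → all? (λ j → H i j ≟B H′ i j))

simple? : ∀ {m} (H : Graph m) → Dec (IsSimple H)
simple? H = all? (λ i → all? (λ j → H i j ≟B H j i)) ×-dec all? (λ i → H i i ≟B false)

complement-simple : ∀ {n} {G : Graph n} → IsSimple G → IsSimple (complement G)
complement-simple {G = G} simple = symmetric , loopless
  where
  symmetric : ∀ u v → complement G u v ≡ complement G v u
  symmetric u v with u ≟F v | v ≟F u
  ... | yes _    | yes _    = refl
  ... | yes refl | no v≢u   = ⊥-elim (v≢u refl)
  ... | no u≢v   | yes refl = ⊥-elim (u≢v refl)
  ... | no _     | no _     = cong not (proj₁ simple u v)
  loopless : ∀ u → complement G u u ≡ false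
  loopless u with u ≟F u
  ... | yes _  = refl
  ... | no u≢u = ⊥-elim (u≢u refl)

complement-involutive : ∀ {n} {G : Graph n} → IsSimple G → complement (complement G) ≈ᴳ G
complement-involutive {G = G} simple u v with u ≟F v
... | yes refl = sym (proj₂ simple u)
... | no _     = not-involutive (G u v)

record Copy {m n} (H : Graph m) (G : Graph n) (A : Subset n) : Set where
  constructor copy
  field
    vertex    : Fin m → Fin n
    injective : Injective _≡_ _≡_ vertex
    adjacency : ∀ i j → H i j ≡ G (vertex i) (vertex j)
    inside    : ∀ i → vertex i ∈ A

module _ {m n} {H : Graph m} {G : Graph n} {A : Subset n} where

  copy-pattern : ∀ {H′} → H ≈ᴳ H′ → Copy H G A → Copy H′ G A
  copy-pattern H≈H′ (copy f inj adj in-A) =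
    copy f inj (λ i j → trans (sym (H≈H′ i j)) (adj i j)) in-A

  copy-host : ∀ {G′} → G ≈ᴳ G′ → Copy H G A → Copy H G′ A
  copy-host G≈G′ (copy f inj adj in-A) =
    copy f inj (λ i j → trans (adj i j) (G≈G′ (f i) (f j))) in-A

  -- An injective map sends equal/unequal pairs to equal/unequal pairs, so a copy
  -- of H in G is also a copy of the complement of H in the complement of G.
  complement-copy : Copy H G A → Copy (complement H) (complement G) A
  complement-copy (copy f inj adj in-A) = copy f inj adjacency in-A
    where
    same-equality : ∀ i j → does (i ≟F j) ≡ does (f i ≟F f j)
    same-equality i j with i ≟F j | f i ≟F f j
    ... | yes _    | yes _     = refl
    ... | yes refl | no fi≢fi  = ⊥-elim (fi≢fi refl)
    ... | no i≢j   | yes fi≡fj = ⊥-elim (i≢j (inj fi≡fj))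
    ... | no _     | no _      = refl
    adjacency : ∀ i j → complement H i j ≡ complement G (f i) (f j)
    adjacency i j =
      cong₂ (λ b c → if b then false else not c) (same-equality i j) (adj i j)

copy-from-complement : ∀ {m n} {H : Graph m} {G : Graph n} {A} →
  IsSimple G → Copy H (complement G) A → Copy (complement H) G A
copy-from-complement simple c = copy-host (complement-involutive simple) (complement-copy c)

pairs : ∀ m → List (Fin m × Fin m)
pairs zero    = []
pairs (suc m) = map (λ j → zero , suc j) (allFin m) ++ map shift (pairs m)
  where
  shift : Fin m × Fin m → Fin (suc m) × Fin (suc m)
  shift (i , j) = suc i , suc j

pairs-complete : ∀ {m} {i j : Fin m} → i < j → (i , j) ∈ₗ pairs m
pairs-complete {suc m} {zero}  {suc j} _ = ∈-++⁺ˡ (∈-map⁺ (λ j → zero , suc j) (∈-allFin j))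
pairs-complete {suc m} {suc i} {suc j} (s≤s i<j) =
  ∈-++⁺ʳ (map (λ j → zero , suc j) (allFin m)) (∈-map⁺ _ (pairs-complete i<j))

-- Twins have the same neighbours.  A copy can only identify twins, since
-- vertices with different neighbourhoods have different images.
Twins : ∀ {m} → Graph m → Fin m × Fin m → Set
Twins H (i , j) = ∀ k → H i k ≡ H j k

twins? : ∀ {m} (H : Graph m) p → Dec (Twins H p)
twins? H (i , j) = all? (λ k → H i k ≟B H j k)

twinPairs : ∀ {m} → Graph m → List (Fin m × Fin m)
twinPairs {m} H = filter (twins? H) (pairs m)

Agrees : ∀ {m n} → Graph m → Graph n → Vec (Fin n) m → Fin m × Fin m → Set
Agrees H G v (i , j) = H i j ≡ G (lookup v i) (lookup v j)

Apart : ∀ {m n} → Vec (Fin n) m → Fin m × Fin m → Set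
Apart v (i , j) = lookup v i ≢ lookup v j

-- A copy of a simple pattern H given by the list v of its vertex images: by
-- symmetry it suffices to check adjacency on the pairs i < j, and injectivity
-- only on pairs of twins.
copyOf : ∀ {m n} {H : Graph m} {G : Graph n} {A : Subset n} →
  IsSimple H → IsSimple G → (v : Vec (Fin n) m) → VAll.All (_∈ A) v →
  All (Agrees H G v) (pairs m) → All (Apart v) (twinPairs H) → Copy H G A
copyOf {m} {n} {H} {G} (symH , loopH) (symG , loopG) v v⊆A agree apart =
  copy f injective adjacency (λ i → VAll.lookup v⊆A (∈-lookup i v))
  where
  f : Fin m → Fin n
  f = lookup v
  adjacency : ∀ i j → H i j ≡ G (f i) (f j)
  adjacency i j with <-cmp i j
  ... | tri< i<j _ _ = All.lookup agree (pairs-complete i<j)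
  ... | tri≈ _ refl _ = trans (loopH i) (sym (loopG (f i)))
  ... | tri> _ _ j<i =
    trans (symH i j) (trans (All.lookup agree (pairs-complete j<i)) (symG (f j) (f i)))
  distinct : ∀ {i j} → i < j → f i ≢ f j
  distinct {i} {j} i<j with twins? H (i , j)
  ... | yes twins = All.lookup apart (∈-filter⁺ (twins? H) (pairs-complete i<j) twins)
  ... | no ¬twins with ¬∀⟶∃¬ m _ (λ k → H i k ≟B H j k) ¬twins
  ...   | k , Hik≢Hjk = λ fi≡fj →
    Hik≢Hjk (trans (adjacency i k) (trans (cong (λ x → G x (f k)) fi≡fj) (sym (adjacency j k))))
  injective : Injective _≡_ _≡_ f
  injective {i} {j} fi≡fj with <-cmp i j
  ... | tri< i<j _ _ = ⊥-elim (distinct i<j fi≡fj)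
  ... | tri≈ _ i≡j _ = i≡j
  ... | tri> _ _ j<i = ⊥-elim (distinct j<i (sym fi≡fj))

cone⁻ : ∀ {m n} {H : Graph m} {G : Graph n} →
  HasInduced (addUniversal H) G → ∃[ x ] Copy H G (N G x)
cone⁻ (f , inj , emb) =
  f zero , copy (f ∘ suc) (suc-injective ∘ inj) (λ i j → emb (suc i) (suc j))
                (λ i → true⇒∈-tabulate (sym (emb zero (suc i))))

cone⁺ : ∀ {m n} {H : Graph m} {G : Graph n} {x} →
  IsSimple G → Copy H G (N G x) → HasInduced (addUniversal H) G
cone⁺ {H = H} {G} {x} simple (copy f inj adj in-N) = x ◂ f , injective , adjacency
  where
  open SimpleGraph simple
  x~f : ∀ i → G x (f i) ≡ true
  x~f i = ∈-tabulate⇒true (in-N i)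
  adjacency : ∀ i j → addUniversal H i j ≡ G ((x ◂ f) i) ((x ◂ f) j)
  adjacency zero    zero    = sym (loop x)
  adjacency zero    (suc j) = sym (x~f j)
  adjacency (suc i) zero    = sym (sym-adj (x~f i))
  adjacency (suc i) (suc j) = adj i j
  injective : Injective _≡_ _≡_ (x ◂ f)
  injective {zero}  {zero}  _ = refl
  injective {zero}  {suc j} e = ⊥-elim (adjacent⇒≢ (x~f j) e)
  injective {suc i} {zero}  e = ⊥-elim (adjacent⇒≢ (x~f i) (sym e))
  injective {suc i} {suc j} e = cong suc (inj e)

induced-pattern : ∀ {m n} {H H′ : Graph m} {G : Graph n} →
  H ≈ᴳ H′ → HasInduced H G → HasInduced H′ G
induced-pattern H≈H′ (f , inj , emb) = f , inj , λ i j → trans (sym (H≈H′ i j)) (emb i j)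

2K2 : Graph 4
2K2 = K2 ⊕ K2

3K2 : Graph 6
3K2 = K2 ⊕ (K2 ⊕ K2)

-- The complement of C4+K1: two triangles sharing the vertex 4.
bowtie : Graph 5
bowtie = complement (C4 ⊕ K1)

bowtie-complement : complement bowtie ≈ᴳ C4 ⊕ K1
bowtie-complement = complement-involutive (from-yes (simple? (C4 ⊕ K1)))

octahedron-complement : complement octahedron ≈ᴳ 3K2
octahedron-complement = complement-involutive (from-yes (simple? 3K2))

module Patterns {n} (G : Graph n) where

  record P4In (A : Subset n) : Set where
    constructor path
    field
      a b c d : Fin n
      a∈ : a ∈ A
      b∈ : b ∈ A
      c∈ : c ∈ A
      d∈ : d ∈ A
      ab : G a b ≡ true
      bc : G b c ≡ true
      cd : G c d ≡ true
      ac : G a c ≡ false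
      bd : G b d ≡ false
      ad : G a d ≡ false

  record C4In (A : Subset n) : Set where
    constructor cycle
    field
      p q r s : Fin n
      p∈ : p ∈ A
      q∈ : q ∈ A
      r∈ : r ∈ A
      s∈ : s ∈ A
      pq : G p q ≡ true
      qr : G q r ≡ true
      rs : G r s ≡ true
      sp : G s p ≡ true
      pr : G p r ≡ false
      qs : G q s ≡ false
      p≢r : p ≢ r
      q≢s : q ≢ s

  record 2K2In (A : Subset n) : Set where
    constructor edges
    field
      a b c d : Fin n
      a∈ : a ∈ A
      b∈ : b ∈ A
      c∈ : c ∈ A
      d∈ : d ∈ A
      ab : G a b ≡ true
      cd : G c d ≡ true
      ac : G a c ≡ false
      ad : G a d ≡ false
      bc : G b c ≡ false
      bd : G b d ≡ false

  record C4K1In (A : Subset n) : Set where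
    constructor cycle+isolated
    field
      cyc : C4In A
      e : Fin n
      e∈ : e ∈ A
      ep : G e (C4In.p cyc) ≡ false
      eq : G e (C4In.q cyc) ≡ false
      er : G e (C4In.r cyc) ≡ false
      es : G e (C4In.s cyc) ≡ false

  record 3K2In (A : Subset n) : Set where
    constructor three-edges
    field
      a b c d e f : Fin n
      a∈ : a ∈ A
      b∈ : b ∈ A
      c∈ : c ∈ A
      d∈ : d ∈ A
      e∈ : e ∈ A
      f∈ : f ∈ A
      ab : G a b ≡ true
      cd : G c d ≡ true
      ef : G e f ≡ true
      ac : G a c ≡ false
      ad : G a d ≡ false
      bc : G b c ≡ false
      bd : G b d ≡ false
      ae : G a e ≡ false
      af : G a f ≡ false
      be : G b e ≡ false
      bf : G b f ≡ false
      ce : G c e ≡ false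
      cf : G c f ≡ false
      de : G d e ≡ false
      df : G d f ≡ false

  P4-mono : ∀ {X Y} → X ⊆ Y → P4In X → P4In Y
  P4-mono X⊆Y (path a b c d a∈ b∈ c∈ d∈ ab bc cd ac bd ad) =
    path a b c d (X⊆Y a∈) (X⊆Y b∈) (X⊆Y c∈) (X⊆Y d∈) ab bc cd ac bd ad

module PatternCopies {n} {G : Graph n} (simple : IsSimple G) where
  open Patterns G
  open SimpleGraph simple

  P4-copy : ∀ {A} → P4In A → Copy P4 G A
  P4-copy (path a b c d a∈ b∈ c∈ d∈ ab bc cd ac bd ad) =
    copyOf (from-yes (simple? P4)) simple (a ∷ b ∷ c ∷ d ∷ []) (a∈ ∷ b∈ ∷ c∈ ∷ d∈ ∷ [])
      (sym ab ∷ sym ac ∷ sym ad ∷ sym bc ∷ sym bd ∷ sym cd ∷ []) []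

  C4-copy : ∀ {A} → C4In A → Copy C4 G A
  C4-copy (cycle p q r s p∈ q∈ r∈ s∈ pq qr rs sp pr qs p≢r q≢s) =
    copyOf (from-yes (simple? C4)) simple (p ∷ q ∷ r ∷ s ∷ []) (p∈ ∷ q∈ ∷ r∈ ∷ s∈ ∷ [])
      (sym pq ∷ sym pr ∷ sym (sym-adj sp) ∷ sym qr ∷ sym qs ∷ sym rs ∷ []) (p≢r ∷ q≢s ∷ [])

  2K2-copy : ∀ {A} → 2K2In A → Copy 2K2 G A
  2K2-copy (edges a b c d a∈ b∈ c∈ d∈ ab cd ac ad bc bd) =
    copyOf (from-yes (simple? 2K2)) simple (a ∷ b ∷ c ∷ d ∷ []) (a∈ ∷ b∈ ∷ c∈ ∷ d∈ ∷ [])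
      (sym ab ∷ sym ac ∷ sym ad ∷ sym bc ∷ sym bd ∷ sym cd ∷ []) []

  C4K1-copy : ∀ {A} → C4K1In A → Copy (C4 ⊕ K1) G A
  C4K1-copy (cycle+isolated (cycle p q r s p∈ q∈ r∈ s∈ pq qr rs sp pr qs p≢r q≢s) e e∈ ep eq er es) =
    copyOf (from-yes (simple? (C4 ⊕ K1))) simple
      (p ∷ q ∷ r ∷ s ∷ e ∷ []) (p∈ ∷ q∈ ∷ r∈ ∷ s∈ ∷ e∈ ∷ [])
      (sym pq ∷ sym pr ∷ sym (sym-adj sp) ∷ sym (sym-adj ep) ∷ sym qr ∷ sym qs ∷
       sym (sym-adj eq) ∷ sym rs ∷ sym (sym-adj er) ∷ sym (sym-adj es) ∷ [])
      (p≢r ∷ q≢s ∷ [])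

  3K2-copy : ∀ {A} → 3K2In A → Copy 3K2 G A
  3K2-copy (three-edges a b c d e f a∈ b∈ c∈ d∈ e∈ f∈ ab cd ef ac ad bc bd ae af be bf ce cf de df) =
    copyOf (from-yes (simple? 3K2)) simple
      (a ∷ b ∷ c ∷ d ∷ e ∷ f ∷ []) (a∈ ∷ b∈ ∷ c∈ ∷ d∈ ∷ e∈ ∷ f∈ ∷ [])
      (sym ab ∷ sym ac ∷ sym ad ∷ sym ae ∷ sym af ∷ sym bc ∷ sym bd ∷ sym be ∷ sym bf ∷
       sym cd ∷ sym ce ∷ sym cf ∷ sym de ∷ sym df ∷ sym ef ∷ []) []

  P4-pattern : ∀ {A} → Copy P4 G A → P4In A
  P4-pattern (copy f _ adj in-A) =
    path (f (# 0)) (f (# 1)) (f (# 2)) (f (# 3)) (in-A (# 0)) (in-A (# 1)) (in-A (# 2)) (in-A (# 3))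
      (sym (adj (# 0) (# 1))) (sym (adj (# 1) (# 2))) (sym (adj (# 2) (# 3)))
      (sym (adj (# 0) (# 2))) (sym (adj (# 1) (# 3))) (sym (adj (# 0) (# 3)))

  -- the complement of the path 0-1-2-3 is the path 2-0-3-1
  P4-from-complement : ∀ {A} → Copy (complement P4) G A → P4In A
  P4-from-complement (copy f _ adj in-A) =
    path (f (# 2)) (f (# 0)) (f (# 3)) (f (# 1)) (in-A (# 2)) (in-A (# 0)) (in-A (# 3)) (in-A (# 1))
      (sym (adj (# 2) (# 0))) (sym (adj (# 0) (# 3))) (sym (adj (# 3) (# 1)))
      (sym (adj (# 2) (# 3))) (sym (adj (# 0) (# 1))) (sym (adj (# 2) (# 1)))

  -- the complement of the cycle 0-1-2-3-0 consists of the edges 02 and 13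
  2K2-from-complement-C4 : ∀ {A} → Copy (complement C4) G A → 2K2In A
  2K2-from-complement-C4 (copy f _ adj in-A) =
    edges (f (# 0)) (f (# 2)) (f (# 1)) (f (# 3)) (in-A (# 0)) (in-A (# 2)) (in-A (# 1)) (in-A (# 3))
      (sym (adj (# 0) (# 2))) (sym (adj (# 1) (# 3))) (sym (adj (# 0) (# 1)))
      (sym (adj (# 0) (# 3))) (sym (adj (# 2) (# 1))) (sym (adj (# 2) (# 3)))

  C4K1-pattern : ∀ {A} → Copy (C4 ⊕ K1) G A → C4K1In A
  C4K1-pattern (copy f inj adj in-A) =
    cycle+isolated
      (cycle (f (# 0)) (f (# 1)) (f (# 2)) (f (# 3)) (in-A (# 0)) (in-A (# 1)) (in-A (# 2)) (in-A (# 3))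
        (sym (adj (# 0) (# 1))) (sym (adj (# 1) (# 2))) (sym (adj (# 2) (# 3))) (sym (adj (# 3) (# 0)))
        (sym (adj (# 0) (# 2))) (sym (adj (# 1) (# 3))) (λ e → 0≢2 (inj e)) (λ e → 1≢3 (inj e)))
      (f (# 4)) (in-A (# 4))
      (sym (adj (# 4) (# 0))) (sym (adj (# 4) (# 1))) (sym (adj (# 4) (# 2))) (sym (adj (# 4) (# 3)))
    where
    0≢2 : # 0 ≢ # 2
    0≢2 ()
    1≢3 : # 1 ≢ # 3
    1≢3 ()

  3K2-pattern : ∀ {A} → Copy 3K2 G A → 3K2In A
  3K2-pattern (copy f _ adj in-A) =
    three-edges (f (# 0)) (f (# 1)) (f (# 2)) (f (# 3)) (f (# 4)) (f (# 5))
      (in-A (# 0)) (in-A (# 1)) (in-A (# 2)) (in-A (# 3)) (in-A (# 4)) (in-A (# 5))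
      (sym (adj (# 0) (# 1))) (sym (adj (# 2) (# 3))) (sym (adj (# 4) (# 5)))
      (sym (adj (# 0) (# 2))) (sym (adj (# 0) (# 3))) (sym (adj (# 1) (# 2))) (sym (adj (# 1) (# 3)))
      (sym (adj (# 0) (# 4))) (sym (adj (# 0) (# 5))) (sym (adj (# 1) (# 4))) (sym (adj (# 1) (# 5)))
      (sym (adj (# 2) (# 4))) (sym (adj (# 2) (# 5))) (sym (adj (# 3) (# 4))) (sym (adj (# 3) (# 5)))

counterexample : ∀ {A B : Set} → Dec A → ¬ (A → B) → A × ¬ B
counterexample (yes a) ¬a→b = a , λ b → ¬a→b (λ _ → b)
counterexample (no ¬a) ¬a→b = ⊥-elim (¬a→b (λ a → ⊥-elim (¬a a)))

module Greatest {n} {T : Subset n} (_≤_ : Fin n → Fin n → Set)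
    (≤-refl : ∀ {u} → u ≤ u)
    (≤-trans : ∀ {u v w} → u ∈ T → w ∈ T → u ≤ v → v ≤ w → u ≤ w)
    (≤-total : ∀ {u v} → u ∈ T → v ∈ T → u ≤ v ⊎ v ≤ u) where

  bound : ∀ {h} → h ∈ T → (xs : List (Fin n)) → ∃[ v ] v ∈ T × (∀ u → u ∈ₗ xs → u ∈ T → u ≤ v)
  bound h∈T [] = _ , h∈T , λ _ ()
  bound h∈T (x ∷ xs) with bound h∈T xs | x ∈? T
  ... | v , v∈T , above | no x∉T =
    v , v∈T , λ { u (here refl) u∈T → ⊥-elim (x∉T u∈T) ; u (there u∈xs) → above u u∈xs }
  ... | v , v∈T , above | yes x∈T with ≤-total x∈T v∈T
  ...   | inj₁ x≤v = v , v∈T , λ { u (here refl) _ → x≤v ; u (there u∈xs) → above u u∈xs }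
  ...   | inj₂ v≤x = x , x∈T , λ { u (here refl) _ → ≤-refl
                                 ; u (there u∈xs) u∈T → ≤-trans u∈T x∈T (above u u∈xs u∈T) v≤x }

  greatest : Nonempty T → ∃[ v ] v ∈ T × (∀ u → u ∈ T → u ≤ v)
  greatest (h , h∈T) with bound h∈T (allFin n)
  ... | v , v∈T , above = v , v∈T , λ u → above u (∈-allFin u)

image : ∀ {m n} → (Fin m → Fin n) → Subset n
image f = ⟦ (λ v → any? (λ i → f i ≟F v)) ⟧

image∋ : ∀ {m n} (f : Fin m → Fin n) i → f i ∈ image f
image∋ f i = ∈⟦⟧⁺ (λ v → any? (λ i → f i ≟F v)) (i , refl)

image⁻ : ∀ {m n} (f : Fin m → Fin n) {v} → v ∈ image f → ∃[ i ] f i ≡ v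
image⁻ f = ∈⟦⟧⁻ (λ v → any? (λ i → f i ≟F v))

image-⊆ : ∀ {m n} {f : Fin m → Fin n} {S} → (∀ i → f i ∈ S) → image f ⊆ S
image-⊆ {f = f} in-S v∈ with image⁻ f v∈
... | i , refl = in-S i

Mixed : ∀ {m} → Graph m → Set
Mixed {m} H = ∀ i → (∃[ k ] H i k ≡ true) × (∃[ k ] k ≢ i × H i k ≡ false)

mixed? : ∀ {m} (H : Graph m) → Dec (Mixed H)
mixed? H = all? λ i → any? (λ k → H i k ≟B true) ×-dec
                      any? (λ k → ¬? (k ≟F i) ×-dec H i k ≟B false)

-- Threshold graphs are exactly the graphs without induced P4, C4 and 2K2
-- (Chvátal–Hammer); both directions are proved for induced subgraphs G[S].
module Threshold {n} {G : Graph n} (simple : IsSimple G) where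
  open Patterns G
  open PatternCopies simple
  open SimpleGraph simple

  _≼[_]_ : Fin n → Subset n → Fin n → Set
  u ≼[ T ] v = ∀ x → x ∈ T → G u x ≡ true → x ≢ v → G v x ≡ true

  -- Transitivity on T; when x is the middle vertex v itself, symmetry turns
  -- the two hypotheses around.
  ≼-trans : ∀ {T u v w} → u ∈ T → w ∈ T → u ≼[ T ] v → v ≼[ T ] w → u ≼[ T ] w
  ≼-trans {T} {u} {v} {w} u∈T w∈T u≼v v≼w x x∈T ux x≢w with x ≟F v
  ... | no x≢v = v≼w x x∈T (u≼v x x∈T ux x≢v) x≢w
  ... | yes refl with u ≟F w
  ...   | yes refl = ux
  ...   | no u≢w =
    sym-adj (u≼v w w∈T (sym-adj (v≼w u u∈T (sym-adj ux) u≢w)) (λ w≡x → x≢w (sym w≡x)))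

  NotBelow : Subset n → Fin n → Fin n → Set
  NotBelow T u v = ∃[ x ] x ∈ T × G u x ≡ true × x ≢ v × G v x ≡ false

  ≼-step? : ∀ T u v x → Dec (x ∈ T → G u x ≡ true → x ≢ v → G v x ≡ true)
  ≼-step? T u v x = x ∈? T →-dec G u x ≟B true →-dec ¬? (x ≟F v) →-dec G v x ≟B true

  compare : ∀ T u v → u ≼[ T ] v ⊎ NotBelow T u v
  compare T u v with all? (≼-step? T u v)
  ... | yes u≼v = inj₁ (λ x → u≼v x)
  ... | no u⋠v =
    let x , ¬step    = ¬∀⟶∃¬ n _ (≼-step? T u v) u⋠v
        x∈T , ¬step₁ = counterexample (x ∈? T) ¬step
        ux , ¬step₂  = counterexample (G u x ≟B true) ¬step₁
        x≢v , ¬vx    = counterexample (¬? (x ≟F v)) ¬step₂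
    in inj₂ (x , x∈T , ux , x≢v , ¬-not ¬vx)

  ≼-total : ∀ {S T} → ¬ P4In S → ¬ C4In S → ¬ 2K2In S → T ⊆ S →
            ∀ {u v} → u ∈ T → v ∈ T → u ≼[ T ] v ⊎ v ≼[ T ] u
  ≼-total {S} {T} noP4 noC4 no2K2 T⊆S {u} {v} u∈T v∈T with compare T u v | compare T v u
  ... | inj₁ u≼v | _        = inj₁ u≼v
  ... | inj₂ _   | inj₁ v≼u = inj₂ v≼u
  ... | inj₂ (a , a∈T , ua , a≢v , va) | inj₂ (b , b∈T , vb , b≢u , ub)
    with G u v in uv | G a b in ab
  ...   | true  | true  = ⊥-elim (noC4 (cycle u a b v (T⊆S u∈T) (T⊆S a∈T) (T⊆S b∈T) (T⊆S v∈T)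
                            ua ab (sym-adj vb) (sym-adj uv) ub (sym-adj va) (λ e → b≢u (sym e)) a≢v))
  ...   | true  | false = ⊥-elim (noP4 (path a u v b (T⊆S a∈T) (T⊆S u∈T) (T⊆S v∈T) (T⊆S b∈T)
                            (sym-adj ua) uv vb (sym-adj va) ub ab))
  ...   | false | true  = ⊥-elim (noP4 (path u a b v (T⊆S u∈T) (T⊆S a∈T) (T⊆S b∈T) (T⊆S v∈T)
                            ua ab (sym-adj vb) ub (sym-adj va) uv))
  ...   | false | false = ⊥-elim (no2K2 (edges u a v b (T⊆S u∈T) (T⊆S a∈T) (T⊆S v∈T) (T⊆S b∈T)
                            ua vb uv ub (sym-adj va) ab))

  -- Below a ≼-greatest vertex v of T, a vertex w ∈ T not adjacent to v is
  -- isolated in T: a neighbour y of w would force v to be adjacent to w.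
  isolated-below-top : ∀ {T v w} → (∀ u → u ∈ T → u ≼[ T ] v) → w ∈ T → w ≢ v → G v w ≡ false →
                       ∀ y → y ∈ T → y ≢ w → G w y ≡ false
  isolated-below-top top w∈T w≢v vw y y∈T _ =
    ¬-not λ wy → true≢false (trans (sym (top y y∈T _ w∈T (sym-adj wy) w≢v)) vw)

  universal-step? : ∀ T v w → Dec (w ∈ T → w ≢ v → G v w ≡ true)
  universal-step? T v w = w ∈? T →-dec ¬? (w ≟F v) →-dec G v w ≟B true

  -- Without P4, C4 and 2K2, a ≼-greatest vertex of T is universal in T, or
  -- else any of its non-neighbours is isolated in T.
  threshold : ∀ {S} → ¬ P4In S → ¬ C4In S → ¬ 2K2In S → IsThreshold G S
  threshold noP4 noC4 no2K2 T T⊆S nonempty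
    with Greatest.greatest (λ u v → u ≼[ T ] v) (λ _ _ ux _ → ux) ≼-trans
                           (≼-total noP4 noC4 no2K2 T⊆S) nonempty
  ... | v , v∈T , top with all? (universal-step? T v)
  ...   | yes universal = v , v∈T , inj₂ (λ w → universal w)
  ...   | no ¬universal =
    let w , ¬step     = ¬∀⟶∃¬ n _ (universal-step? T v) ¬universal
        w∈T , ¬step₁  = counterexample (w ∈? T) ¬step
        w≢v , ¬vw     = counterexample (¬? (w ≟F v)) ¬step₁
    in w , w∈T , inj₁ (isolated-below-top top w∈T w≢v (¬-not ¬vw))

  -- Conversely, the vertices of a copy of a pattern in which every vertex has
  -- a neighbour and a non-neighbour include no isolated or universal vertex.
  mixed-not-threshold : ∀ {m} {H : Graph (suc m)} {S} →
                        Mixed H → Copy H G S → ¬ IsThreshold G S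
  mixed-not-threshold mixed (copy f inj adj in-S) th
    with th (image f) (image-⊆ in-S) (f zero , image∋ f zero)
  ... | v , v∈ , isolated-or-universal with image⁻ f v∈
  ...   | i , refl with isolated-or-universal | mixed i
  ...     | inj₁ isolated  | (k , ik) , _ =
    let fi~fk = trans (sym (adj i k)) ik
    in true≢false (trans (sym fi~fk) (isolated (f k) (image∋ f k) (≢-sym (adjacent⇒≢ fi~fk))))
  ...     | inj₂ universal | _ , (k , k≢i , ik) =
    let fi~fk = universal (f k) (image∋ f k) (λ e → k≢i (inj e))
    in true≢false (trans (sym fi~fk) (trans (sym (adj i k)) ik))

  P4-not-threshold : ∀ {S} → P4In S → ¬ IsThreshold G S
  P4-not-threshold p = mixed-not-threshold (from-yes (mixed? P4)) (P4-copy p)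

  C4-not-threshold : ∀ {S} → C4In S → ¬ IsThreshold G S
  C4-not-threshold c = mixed-not-threshold (from-yes (mixed? C4)) (C4-copy c)

  2K2-not-threshold : ∀ {S} → 2K2In S → ¬ IsThreshold G S
  2K2-not-threshold t = mixed-not-threshold (from-yes (mixed? 2K2)) (2K2-copy t)

GoodSet : ∀ {n} → Graph n → Subset n → Set
GoodSet G A = Empty A ⊎ IsThreshold G A ⊎ IsUnionOfThreshold G A ⊎ IsJoinOfThreshold G A

sides-distinct : ∀ {n} {A B C : Subset n} {b c} → IsPartition A B C → b ∈ B → c ∈ C → b ≢ c
sides-distinct (_ , _ , _ , disjoint) b∈B c∈C refl = disjoint _ b∈B c∈C

Complementary : ∀ {n} → Graph n → Graph n → Set
Complementary {n} G G′ = ∀ {u v : Fin n} → u ≢ v → G′ u v ≡ not (G u v)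

complementary : ∀ {n} (G : Graph n) → Complementary G (complement G)
complementary G {u} {v} u≢v with u ≟F v
... | yes u≡v = ⊥-elim (u≢v u≡v)
... | no _    = refl

complementary-sym : ∀ {n} {G G′ : Graph n} → Complementary G G′ → Complementary G′ G
complementary-sym {G = G} co {u} {v} u≢v =
  trans (sym (not-involutive (G u v))) (cong not (sym (co u≢v)))

-- Complementation exchanges isolated and universal vertices, and unions and
-- joins; hence it preserves thresholdness and goodness of vertex sets.
module Duality {n} {G G′ : Graph n} (co : Complementary G G′) where

  flip-adj : ∀ {u v b} → u ≢ v → G u v ≡ b → G′ u v ≡ not b
  flip-adj u≢v e = trans (co u≢v) (cong not e)

  threshold-dual : ∀ {S} → IsThreshold G S → IsThreshold G′ S
  threshold-dual th T T⊆S nonempty with th T T⊆S nonempty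
  ... | v , v∈T , inj₁ isolated  =
    v , v∈T , inj₂ (λ w w∈T w≢v → flip-adj (≢-sym w≢v) (isolated w w∈T w≢v))
  ... | v , v∈T , inj₂ universal =
    v , v∈T , inj₁ (λ w w∈T w≢v → flip-adj (≢-sym w≢v) (universal w w∈T w≢v))

  union⇒join : ∀ {A} → IsUnionOfThreshold G A → IsJoinOfThreshold G′ A
  union⇒join (B , C , part , thB , thC , BC) =
    B , C , part , threshold-dual thB , threshold-dual thC ,
    λ b c b∈B c∈C → flip-adj (sides-distinct part b∈B c∈C) (BC b c b∈B c∈C)

  join⇒union : ∀ {A} → IsJoinOfThreshold G A → IsUnionOfThreshold G′ A
  join⇒union (B , C , part , thB , thC , BC) =
    B , C , part , threshold-dual thB , threshold-dual thC ,
    λ b c b∈B c∈C → flip-adj (sides-distinct part b∈B c∈C) (BC b c b∈B c∈C)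

  good-dual : ∀ {A} → GoodSet G A → GoodSet G′ A
  good-dual (inj₁ empty)                = inj₁ empty
  good-dual (inj₂ (inj₁ th))            = inj₂ (inj₁ (threshold-dual th))
  good-dual (inj₂ (inj₂ (inj₁ union)))  = inj₂ (inj₂ (inj₂ (union⇒join union)))
  good-dual (inj₂ (inj₂ (inj₂ join)))   = inj₂ (inj₂ (inj₁ (join⇒union join)))

module Sides {n} {G : Graph n} (simple : IsSimple G) {A : Subset n} where
  open SimpleGraph simple

  -- A partition of A into threshold sets with adjacency not b across: a
  -- union for b = true, a join for b = false.
  Split : Bool → Set
  Split b = Σ (Subset n) λ B → Σ (Subset n) λ C →
    IsPartition A B C × IsThreshold G B × IsThreshold G C ×
    (∀ x y → x ∈ B → y ∈ C → G x y ≡ not b)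

  Side : Bool → Subset n → Set
  Side b X = IsThreshold G X × (∀ {x y} → x ∈ X → y ∈ A → G x y ≡ b → y ∈ X)

  closed : ∀ {B C b} → (∀ v → v ∈ A → v ∈ B ⊎ v ∈ C) →
    (∀ x y → x ∈ B → y ∈ C → G x y ≡ not b) → ∀ {x y} → x ∈ B → y ∈ A → G x y ≡ b → y ∈ B
  closed cover BC {x} {y} x∈B y∈A xy with cover y y∈A
  ... | inj₁ y∈B = y∈B
  ... | inj₂ y∈C = ⊥-elim (not-¬ refl (trans (sym xy) (BC x y x∈B y∈C)))

  sides : ∀ {b} → Split b → ∃[ B ] ∃[ C ] Side b B × Side b C × (∀ v → v ∈ A → v ∈ B ⊎ v ∈ C)
  sides (B , C , (cover , _) , thB , thC , BC) =
    B , C , (thB , closed cover BC) ,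
    (thC , closed (λ v v∈A → swap (cover v v∈A)) (λ x y x∈C y∈B → sym-adj (BC y x y∈B x∈C))) ,
    cover

  side : ∀ {b} → Split b → ∀ {x} → x ∈ A → ∃[ X ] Side b X × x ∈ X
  side split {x} x∈A with sides split
  ... | B , C , sideB , sideC , cover with cover x x∈A
  ...   | inj₁ x∈B = B , sideB , x∈B
  ...   | inj₂ x∈C = C , sideC , x∈C

  pigeonhole : ∀ {b} → Split b → ∀ {a c e} → a ∈ A → c ∈ A → e ∈ A →
    ∃[ X ] Side b X × ((a ∈ X × c ∈ X) ⊎ (a ∈ X × e ∈ X) ⊎ (c ∈ X × e ∈ X))
  pigeonhole split {a} {c} {e} a∈A c∈A e∈A with sides split
  ... | B , C , sideB , sideC , cover with cover a a∈A | cover c c∈A | cover e e∈A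
  ...   | inj₁ a∈B | inj₁ c∈B | _        = B , sideB , inj₁ (a∈B , c∈B)
  ...   | inj₂ a∈C | inj₂ c∈C | _        = C , sideC , inj₁ (a∈C , c∈C)
  ...   | inj₁ a∈B | inj₂ _   | inj₁ e∈B = B , sideB , inj₂ (inj₁ (a∈B , e∈B))
  ...   | inj₁ _   | inj₂ c∈C | inj₂ e∈C = C , sideC , inj₂ (inj₂ (c∈C , e∈C))
  ...   | inj₂ _   | inj₁ c∈B | inj₁ e∈B = B , sideB , inj₂ (inj₂ (c∈B , e∈B))
  ...   | inj₂ a∈C | inj₁ _   | inj₂ e∈C = C , sideC , inj₂ (inj₁ (a∈C , e∈C))

module Obstructions {n} {G : Graph n} (simple : IsSimple G) where
  open Patterns G
  open SimpleGraph simple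
  open Threshold simple
  open Sides simple

  -- A P4 is connected and co-connected, so it stays within one side of a
  -- union or a join.
  P4-not-good : ∀ {A} → P4In A → ¬ GoodSet G A
  P4-not-good {A} p = not-good
    where
    open P4In p
    not-good : ¬ GoodSet G A
    not-good (inj₁ empty)     = empty (a , a∈)
    not-good (inj₂ (inj₁ th)) = P4-not-threshold p th
    not-good (inj₂ (inj₂ (inj₁ union))) with side union a∈
    ... | X , (thX , closed) , a∈X =
      let b∈X = closed a∈X b∈ ab ; c∈X = closed b∈X c∈ bc ; d∈X = closed c∈X d∈ cd
      in P4-not-threshold (path a b c d a∈X b∈X c∈X d∈X ab bc cd ac bd ad) thX
    not-good (inj₂ (inj₂ (inj₂ join))) with side join c∈
    ... | X , (thX , closed) , c∈X =
      let a∈X = closed c∈X a∈ (sym-adj ac) ; d∈X = closed a∈X d∈ ad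
          b∈X = closed d∈X b∈ (sym-adj bd)
      in P4-not-threshold (path a b c d a∈X b∈X c∈X d∈X ab bc cd ac bd ad) thX

  -- The 4-cycle stays within one side of a union; in a join the isolated
  -- vertex drags the whole cycle onto its side.
  C4K1-not-good : ∀ {A} → C4K1In A → ¬ GoodSet G A
  C4K1-not-good {A} c4k1 = not-good
    where
    open C4K1In c4k1
    open C4In cyc
    not-good : ¬ GoodSet G A
    not-good (inj₁ empty)     = empty (e , e∈)
    not-good (inj₂ (inj₁ th)) = C4-not-threshold cyc th
    not-good (inj₂ (inj₂ (inj₁ union))) with side union p∈
    ... | X , (thX , closed) , p∈X =
      let q∈X = closed p∈X q∈ pq ; r∈X = closed q∈X r∈ qr ; s∈X = closed r∈X s∈ rs
      in C4-not-threshold (cycle p q r s p∈X q∈X r∈X s∈X pq qr rs sp pr qs p≢r q≢s) thX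
    not-good (inj₂ (inj₂ (inj₂ join))) with side join e∈
    ... | X , (thX , closed) , e∈X =
      let p∈X = closed e∈X p∈ ep ; q∈X = closed e∈X q∈ eq
          r∈X = closed e∈X r∈ er ; s∈X = closed e∈X s∈ es
      in C4-not-threshold (cycle p q r s p∈X q∈X r∈X s∈X pq qr rs sp pr qs p≢r q≢s) thX

  -- Two of the three edges lie on a common side of a union; in a join the
  -- whole 3K2 stays on one side.
  3K2-not-good : ∀ {A} → 3K2In A → ¬ GoodSet G A
  3K2-not-good {A} t = not-good
    where
    open 3K2In t
    not-good : ¬ GoodSet G A
    not-good (inj₁ empty)     = empty (a , a∈)
    not-good (inj₂ (inj₁ th)) = 2K2-not-threshold (edges a b c d a∈ b∈ c∈ d∈ ab cd ac ad bc bd) th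
    not-good (inj₂ (inj₂ (inj₁ union))) with pigeonhole union a∈ c∈ e∈
    ... | X , (thX , closed) , inj₁ (a∈X , c∈X) =
      2K2-not-threshold (edges a b c d a∈X (closed a∈X b∈ ab) c∈X (closed c∈X d∈ cd)
                               ab cd ac ad bc bd) thX
    ... | X , (thX , closed) , inj₂ (inj₁ (a∈X , e∈X)) =
      2K2-not-threshold (edges a b e f a∈X (closed a∈X b∈ ab) e∈X (closed e∈X f∈ ef)
                               ab ef ae af be bf) thX
    ... | X , (thX , closed) , inj₂ (inj₂ (c∈X , e∈X)) =
      2K2-not-threshold (edges c d e f c∈X (closed c∈X d∈ cd) e∈X (closed e∈X f∈ ef)
                               cd ef ce cf de df) thX
    not-good (inj₂ (inj₂ (inj₂ join))) with side join a∈
    ... | X , (thX , closed) , a∈X =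
      let c∈X = closed a∈X c∈ ac ; d∈X = closed a∈X d∈ ad ; b∈X = closed c∈X b∈ (sym-adj bc)
      in 2K2-not-threshold (edges a b c d a∈X b∈X c∈X d∈X ab cd ac ad bc bd) thX

-- The bowtie and the octahedron are the complements of C4+K1 and 3K2, and
-- complementation preserves goodness.
module ComplementObstructions {n} {G : Graph n} (simple : IsSimple G) where
  open Duality (complementary G)
  open PatternCopies (complement-simple simple)
  open Obstructions (complement-simple simple)

  bowtie-not-good : ∀ {A} → Copy bowtie G A → ¬ GoodSet G A
  bowtie-not-good c good =
    C4K1-not-good (C4K1-pattern (copy-pattern bowtie-complement (complement-copy c))) (good-dual good)

  octahedron-not-good : ∀ {A} → Copy octahedron G A → ¬ GoodSet G A
  octahedron-not-good c good =
    3K2-not-good (3K2-pattern (copy-pattern octahedron-complement (complement-copy c))) (good-dual good)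

-- A set A with an induced 2K2 ab, cd but no P4, C4+K1, bowtie or 3K2 is the
-- union of two threshold graphs: the vertices of A within distance two of a,
-- and the rest.
module UnionDecomposition {n} {G : Graph n} (simple : IsSimple G) {A : Subset n}
    (noP4 : ¬ Patterns.P4In G A) (noC4K1 : ¬ Patterns.C4K1In G A)
    (noBowtie : ¬ Copy bowtie G A) (no3K2 : ¬ Patterns.3K2In G A)
    (tk : Patterns.2K2In G A) where
  open Patterns G
  open SimpleGraph simple
  open Threshold simple
  open 2K2In tk

  Near : Fin n → Set
  Near y = y ∈ A × (y ≡ a ⊎ G a y ≡ true ⊎ ∃[ z ] z ∈ A × G a z ≡ true × G z y ≡ true)

  near? : ∀ y → Dec (Near y)
  near? y = y ∈? A ×-dec (y ≟F a ⊎-dec G a y ≟B true ⊎-dec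
                          any? (λ z → z ∈? A ×-dec G a z ≟B true ×-dec G z y ≟B true))

  Far : Fin n → Set
  Far y = y ∈ A × ¬ Near y

  far? : ∀ y → Dec (Far y)
  far? y = y ∈? A ×-dec ¬? (near? y)

  B C : Subset n
  B = ⟦ near? ⟧
  C = ⟦ far? ⟧

  -- No edge leaves the ball of radius two around a: an edge from distance two
  -- to distance three would end an induced P4 starting at a.
  near-far-nonadjacent : ∀ {x y} → Near x → y ∈ A → ¬ Near y → G x y ≡ false
  near-far-nonadjacent (_ , inj₁ refl) y∈A far = ¬-not λ ay → far (y∈A , inj₂ (inj₁ ay))
  near-far-nonadjacent {x} (x∈A , inj₂ (inj₁ ax)) y∈A far =
    ¬-not λ xy → far (y∈A , inj₂ (inj₂ (x , x∈A , ax , xy)))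
  near-far-nonadjacent {x} {y} (x∈A , inj₂ (inj₂ (z , z∈A , az , zx))) y∈A far = ¬-not λ xy →
    noP4 (path a z x y a∈ z∈A x∈A y∈A az zx xy
      (¬-not λ ax → far (y∈A , inj₂ (inj₂ (x , x∈A , ax , xy))))
      (¬-not λ zy → far (y∈A , inj₂ (inj₂ (z , z∈A , az , zy))))
      (¬-not λ ay → far (y∈A , inj₂ (inj₁ ay))))

  -- The far edge xy of a 2K2 ab, xy is at distance at least three from a: a
  -- common neighbour z of a and x yields a P4, or else the bowtie with centre z.
  far-edge : ∀ {x y} → x ∈ A → y ∈ A → G x y ≡ true → G a x ≡ false → G a y ≡ false →
             G b x ≡ false → G b y ≡ false → ¬ Near x
  far-edge x∈ y∈ xy ax ay bx by (_ , inj₁ refl)      = separates {G = G} ab (sym-adj bx) refl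
  far-edge x∈ y∈ xy ax ay bx by (_ , inj₂ (inj₁ ax′)) = true≢false (trans (sym ax′) ax)
  far-edge {x} {y} x∈ y∈ xy ax ay bx by (_ , inj₂ (inj₂ (z , z∈ , az , zx)))
    with G z b in zb | G z y in zy
  ... | false | _     = noP4 (path b a z x b∈ a∈ z∈ x∈ (sym-adj ab) az zx (sym-adj zb) ax bx)
  ... | true  | false = noP4 (path y x z b y∈ x∈ z∈ b∈ (sym-adj xy) (sym-adj zx) zb
                                   (sym-adj zy) (sym-adj bx) (sym-adj by))
  ... | true  | true  = noBowtie (copyOf (from-yes (simple? bowtie)) simple
      (a ∷ x ∷ b ∷ y ∷ z ∷ []) (a∈ ∷ x∈ ∷ b∈ ∷ y∈ ∷ z∈ ∷ [])
      (sym ax ∷ sym ab ∷ sym ay ∷ sym az ∷ sym (sym-adj bx) ∷ sym xy ∷ sym (sym-adj zx) ∷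
       sym by ∷ sym (sym-adj zb) ∷ sym (sym-adj zy) ∷ []) [])

  B⊆A : B ⊆ A
  B⊆A x∈B = proj₁ (∈⟦⟧⁻ near? x∈B)

  C⊆A : C ⊆ A
  C⊆A x∈C = proj₁ (∈⟦⟧⁻ far? x∈C)

  a∈B : a ∈ B
  a∈B = ∈⟦⟧⁺ near? (a∈ , inj₁ refl)

  b∈B : b ∈ B
  b∈B = ∈⟦⟧⁺ near? (b∈ , inj₂ (inj₁ ab))

  c∈C : c ∈ C
  c∈C = ∈⟦⟧⁺ far? (c∈ , far-edge c∈ d∈ cd ac ad bc bd)

  d∈C : d ∈ C
  d∈C = ∈⟦⟧⁺ far? (d∈ , far-edge d∈ c∈ (sym-adj cd) ad ac bd bc)

  B-C : ∀ x y → x ∈ B → y ∈ C → G x y ≡ false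
  B-C x y x∈B y∈C = near-far-nonadjacent (∈⟦⟧⁻ near? x∈B) (C⊆A y∈C) (proj₂ (∈⟦⟧⁻ far? y∈C))

  C-B : ∀ {x y} → x ∈ C → y ∈ B → G x y ≡ false
  C-B x∈C y∈B = sym-adj (B-C _ _ y∈B x∈C)

  partition : IsPartition A B C
  partition = cover , (λ _ → B⊆A) , (λ _ → C⊆A) ,
              λ v v∈B v∈C → proj₂ (∈⟦⟧⁻ far? v∈C) (∈⟦⟧⁻ near? v∈B)
    where
    cover : ∀ v → v ∈ A → v ∈ B ⊎ v ∈ C
    cover v v∈A with near? v
    ... | yes near = inj₁ (∈⟦⟧⁺ near? near)
    ... | no far   = inj₂ (∈⟦⟧⁺ far? (v∈A , far))

  -- A C4 or 2K2 on one side, together with a vertex or an edge of the 2K2 on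
  -- the other side, would be a C4+K1 or a 3K2.
  B-threshold : IsThreshold G B
  B-threshold = threshold (noP4 ∘ P4-mono B⊆A) noC4 no2K2
    where
    noC4 : ¬ C4In B
    noC4 (cycle p q r s p∈ q∈ r∈ s∈ pq qr rs sp pr qs p≢r q≢s) =
      noC4K1 (cycle+isolated
        (cycle p q r s (B⊆A p∈) (B⊆A q∈) (B⊆A r∈) (B⊆A s∈) pq qr rs sp pr qs p≢r q≢s)
        c c∈ (C-B c∈C p∈) (C-B c∈C q∈) (C-B c∈C r∈) (C-B c∈C s∈))
    no2K2 : ¬ 2K2In B
    no2K2 (edges x y z w x∈ y∈ z∈ w∈ xy zw xz xw yz yw) =
      no3K2 (three-edges x y z w c d (B⊆A x∈) (B⊆A y∈) (B⊆A z∈) (B⊆A w∈) c∈ d∈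
               xy zw cd xz xw yz yw
               (B-C x c x∈ c∈C) (B-C x d x∈ d∈C) (B-C y c y∈ c∈C) (B-C y d y∈ d∈C)
               (B-C z c z∈ c∈C) (B-C z d z∈ d∈C) (B-C w c w∈ c∈C) (B-C w d w∈ d∈C))

  C-threshold : IsThreshold G C
  C-threshold = threshold (noP4 ∘ P4-mono C⊆A) noC4 no2K2
    where
    noC4 : ¬ C4In C
    noC4 (cycle p q r s p∈ q∈ r∈ s∈ pq qr rs sp pr qs p≢r q≢s) =
      noC4K1 (cycle+isolated
        (cycle p q r s (C⊆A p∈) (C⊆A q∈) (C⊆A r∈) (C⊆A s∈) pq qr rs sp pr qs p≢r q≢s)
        a a∈ (B-C a p a∈B p∈) (B-C a q a∈B q∈) (B-C a r a∈B r∈) (B-C a s a∈B s∈))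
    no2K2 : ¬ 2K2In C
    no2K2 (edges x y z w x∈ y∈ z∈ w∈ xy zw xz xw yz yw) =
      no3K2 (three-edges a b x y z w a∈ b∈ (C⊆A x∈) (C⊆A y∈) (C⊆A z∈) (C⊆A w∈) ab xy zw
               (B-C a x a∈B x∈) (B-C a y a∈B y∈) (B-C b x b∈B x∈) (B-C b y b∈B y∈)
               (B-C a z a∈B z∈) (B-C a w a∈B w∈) (B-C b z b∈B z∈) (B-C b w b∈B w∈) xz xw yz yw)

  union : IsUnionOfThreshold G A
  union = B , C , partition , B-threshold , C-threshold , B-C

2K2? : ∀ {n} (G : Graph n) (A : Subset n) → Dec (Patterns.2K2In G A)
2K2? G A = map′
  (λ (a , b , c , d , a∈ , b∈ , c∈ , d∈ , ab , cd , ac , ad , bc , bd) →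
     edges a b c d a∈ b∈ c∈ d∈ ab cd ac ad bc bd)
  (λ (edges a b c d a∈ b∈ c∈ d∈ ab cd ac ad bc bd) →
     a , b , c , d , a∈ , b∈ , c∈ , d∈ , ab , cd , ac , ad , bc , bd)
  (any? λ a → any? λ b → any? λ c → any? λ d →
     a ∈? A ×-dec b ∈? A ×-dec c ∈? A ×-dec d ∈? A ×-dec
     G a b ≟B true ×-dec G c d ≟B true ×-dec G a c ≟B false ×-dec
     G a d ≟B false ×-dec G b c ≟B false ×-dec G b d ≟B false)
  where open Patterns G

-- A vertex set without the five obstructions is good: with a 2K2 it is a
-- union of two threshold graphs; with a C4, i.e. a 2K2 in the complement, it
-- is dually a join; otherwise it is threshold.
module GoodSets {n} {G : Graph n} (simple : IsSimple G) where
  open Patterns G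
  open PatternCopies simple
  open Threshold simple
  private
    co-simple = complement-simple simple
    module Co = PatternCopies co-simple

  good-set : ∀ {A} → ¬ P4In A → ¬ C4K1In A → ¬ Copy bowtie G A → ¬ 3K2In A →
             ¬ Copy octahedron G A → GoodSet G A
  good-set {A} noP4 noC4K1 noBowtie no3K2 noOctahedron with 2K2? G A
  ... | yes tk = inj₂ (inj₂ (inj₁ (UnionDecomposition.union simple noP4 noC4K1 noBowtie no3K2 tk)))
  ... | no no2K2 with 2K2? (complement G) A
  ...   | no no2K2ᶜ = inj₂ (inj₁ (threshold noP4 noC4 no2K2))
    where
    noC4 : ¬ C4In A
    noC4 c4 = no2K2ᶜ (Co.2K2-from-complement-C4 (complement-copy (C4-copy c4)))
  ...   | yes tkᶜ =
    inj₂ (inj₂ (inj₂ (Duality.union⇒join (complementary-sym (complementary G))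
      (UnionDecomposition.union co-simple noP4ᶜ noC4K1ᶜ noBowtieᶜ no3K2ᶜ tkᶜ))))
    where
    -- the complement of each obstruction is again one
    noP4ᶜ : ¬ Patterns.P4In (complement G) A
    noP4ᶜ p = noP4 (P4-from-complement (copy-from-complement simple (Co.P4-copy p)))
    noC4K1ᶜ : ¬ Patterns.C4K1In (complement G) A
    noC4K1ᶜ q = noBowtie (copy-from-complement simple (Co.C4K1-copy q))
    noBowtieᶜ : ¬ Copy bowtie (complement G) A
    noBowtieᶜ c = noC4K1 (C4K1-pattern (copy-pattern bowtie-complement (copy-from-complement simple c)))
    no3K2ᶜ : ¬ Patterns.3K2In (complement G) A
    no3K2ᶜ t = noOctahedron (copy-from-complement simple (Co.3K2-copy t))

-- Local complementation of C4+K1-univ at its apex complements C4+K1, giving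
-- the cone over the bowtie.
lc-is-cone : C4+K1-univ-lc ≈ᴳ addUniversal bowtie
lc-is-cone = from-yes (C4+K1-univ-lc ≈ᴳ? addUniversal bowtie)

cone-is-lc : addUniversal bowtie ≈ᴳ C4+K1-univ-lc
cone-is-lc i j = sym (lc-is-cone i j)

ConeFree : ∀ {n} → Graph n → Set
ConeFree G = ¬ HasInduced gem G × ¬ HasInduced C4+K1-univ G ×
             ¬ HasInduced C4+K1-univ-lc G × ¬ HasInduced 3K2-univ G × ¬ HasInduced octahedron-univ G

no-cone : ∀ {m n} {H : Graph m} {G : Graph n} → (∀ {A} → Copy H G A → ¬ GoodSet G A) →
          Good G → ¬ HasInduced (addUniversal H) G
no-cone bad good cone = let x , c = cone⁻ cone in bad c (good x)

good⇒cone-free : ∀ {n} {G : Graph n} → IsSimple G → Good G → ConeFree G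
good⇒cone-free {G = G} simple good =
    no-cone (λ c → P4-not-good (P4-pattern c)) good
  , no-cone (λ c → C4K1-not-good (C4K1-pattern c)) good
  , no-cone bowtie-not-good good ∘ induced-pattern {G = G} lc-is-cone
  , no-cone (λ c → 3K2-not-good (3K2-pattern c)) good
  , no-cone octahedron-not-good good
  where
  open PatternCopies simple
  open Obstructions simple
  open ComplementObstructions simple

cone-free⇒good : ∀ {n} {G : Graph n} → IsSimple G → ConeFree G → Good G
cone-free⇒good {G = G} simple (noGem , noC4K1 , noLc , no3K2 , noOctahedron) x =
  good-set (noGem ∘ cone⁺ simple ∘ P4-copy) (noC4K1 ∘ cone⁺ simple ∘ C4K1-copy)
           (noLc ∘ induced-pattern {G = G} cone-is-lc ∘ cone⁺ simple)
           (no3K2 ∘ cone⁺ simple ∘ 3K2-copy) (noOctahedron ∘ cone⁺ simple)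
  where
  open PatternCopies simple
  open GoodSets simple

theorem4 : ∀ (n : ℕ) (G : Graph n) → IsSimple G →
    Good G ⇔ (¬ HasInduced gem G × ¬ HasInduced C4+K1-univ G ×
              ¬ HasInduced C4+K1-univ-lc G × ¬ HasInduced 3K2-univ G ×
              ¬ HasInduced octahedron-univ G)
theorem4 n G simple = mk⇔ (good⇒cone-free simple) (cone-free⇒good simple)
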